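{- For all $n\ge 4$, $\beta(P_\infty\Box K_n)=n-1$, and $S=\{(0,0),(0,1),\dots,(0,n-2)\}$ is a metric basis of $P_\infty\Box K_n$.
   Context: $P_\infty$ has vertex set $\mathbb{N}=\{0,1,2,\dots\}$ with $i,j$ adjacent iff $|i-j|=1$. $K_n$ is the complete graph on vertex set $\{0,1,\dots,n-1\}$. The cartesian product $G\Box H$ has vertex set $V(G)\times V(H)$, with $(a,v)$ adjacent to $(b,w)$ iff either $a=b$ and $vw\in E(H)$, or $v=w$ and $ab\in E(G)$. $d$ is the shortest-path distance. A vertex $x$ resolves $u,v$ if $d(u,x)\neq d(v,x)$; a set $S$ is a resolving set if every pair of distinct vertices is resolved by some vertex of $S$; a metric basis is a resolving set of minimum cardinality and $\beta$ (metric dimension) is its cardinality (infinite if no finite resolving set exists). -}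

module Defs where

open import Data.Nat as ℕ using (ℕ; zero; suc; _≤_)
open import Data.Fin using (Fin; inject₁)
open import Data.List using (List; map; length; allFin)
open import Data.List.Relation.Unary.Any using (Any)
open import Data.List.Relation.Unary.Unique.Propositional using (Unique)
open import Data.Product using (_×_; _,_; ∃-syntax)
open import Data.Sum using (_⊎_)
open import Relation.Binary.PropositionalEquality using (_≡_; _≢_)

record Graph : Set₁ where
  field
    V   : Set
    Adj : V → V → Set
open Graph public

P∞ : Graph
P∞ = record { V = ℕ ; Adj = λ i j → (suc i ≡ j) ⊎ (suc j ≡ i) }

K : ℕ → Graph
K n = record { V = Fin n ; Adj = λ i j → i ≢ j }

_□_ : Graph → Graph → Graph
G □ H = record
  { V = V G × V H
  ; Adj = λ { (a , v) (b , w) → (a ≡ b × Adj H v w) ⊎ (v ≡ w × Adj G a b) } }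

data Walk (G : Graph) : V G → V G → ℕ → Set where
  here : ∀ {u} → Walk G u u 0
  step : ∀ {u w v k} → Adj G u w → Walk G w v k → Walk G u v (suc k)

Dist : (G : Graph) → V G → V G → ℕ → Set
Dist G u v k = Walk G u v k × (∀ m → Walk G u v m → k ≤ m)

Resolves : (G : Graph) → V G → V G → V G → Set
Resolves G x u v = ∃[ k₁ ] ∃[ k₂ ] (Dist G u x k₁ × Dist G v x k₂ × k₁ ≢ k₂)

-- finite vertex sets are represented by duplicate-free lists; card = length
Resolving : (G : Graph) → List (V G) → Set
Resolving G S = ∀ u v → u ≢ v → Any (λ x → Resolves G x u v) S

IsMetricBasis : (G : Graph) → List (V G) → Set
IsMetricBasis G S =
  Unique S × Resolving G S
  × (∀ (T : List (V G)) → Unique T → Resolving G T → length S ≤ length T)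

MetricDim : (G : Graph) → ℕ → Set
MetricDim G k =
  (∃[ S ] (Unique S × Resolving G S × length S ≡ k))
  × (∀ (T : List (V G)) → Unique T → Resolving G T → k ≤ length T)

-- S = {(0,0),(0,1),…,(0,n-2)} in P_∞ □ K_(m+1), i.e. n = m + 1
basisS : (m : ℕ) → List (V (P∞ □ K (suc m)))
basisS m = map (λ i → (0 , inject₁ i)) (allFin m)

-- A function d : V G → V G → ℕ is a distance function for G when
-- every pair u, v is joined by a walk of length d u v and no walk is shorter.  We show that ∣_-_∣ is a distance function for P∞, that the
-- discrete metric δ (0 on the diagonal, 1 off it) is one for Kₙ, and that
-- distance functions add up along a cartesian product.
--
-- If a list T of vertices of G □ K (suc m) has fewer than m
-- elements, two colours v, w of K (suc m) occur in no vertex of T; then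
-- (a , v) and (a , w) are equidistant from every vertex of T, so T does not
-- resolve.  S = {(0,0),…,(0,m-1)} resolves: vertices in one
-- layer a are told apart by a landmark of one of their colours, and vertices
-- in different layers a ≠ b by a landmark whose colour is neither of theirs
-- (it exists as soon as m ≥ 3); its distances to them are a + 1 and b + 1.

module Submission where

open import Defs
open import Data.Nat using (ℕ; zero; suc; _≤_; _<_; _∸_; _+_; ∣_-_∣; z≤n; s≤s; s≤s⁻¹)
open import Data.Nat.Properties
open import Data.Fin using (Fin; inject₁; toℕ; lower₁)
open import Data.Fin.Properties as Fin
  using (inject₁-injective; inject₁-lower₁; toℕ-injective; <⇒notInjective; ¬∀⟶∃¬)
open import Data.List using (List; []; _∷_; map; length; allFin; lookup)
open import Data.List.Properties using (length-map; length-tabulate)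
open import Data.List.Relation.Unary.Any using (Any; here; there)
open import Data.List.Relation.Unary.Any.Properties using (lookup-index)
open import Data.List.Membership.Propositional using (_∈_; _∉_; find; lose)
open import Data.List.Membership.Propositional.Properties using (∈-map⁺; ∈-allFin)
open import Data.List.Relation.Unary.Unique.Propositional using (Unique)
import Data.List.Relation.Unary.Unique.Propositional.Properties as Unique
open import Data.Product using (_×_; _,_; proj₂; ∃-syntax)
open import Data.Sum using (_⊎_; inj₁; inj₂)
open import Data.Empty using (⊥-elim)
open import Function.Definitions using (Injective)
open import Relation.Nullary using (¬_; yes; no)
open import Relation.Binary.PropositionalEquality

_++ʷ_ : ∀ {G u w v k l} → Walk G u w k → Walk G w v l → Walk G u v (k + l)
here       ++ʷ W′ = W′
step e W   ++ʷ W′ = step e (W ++ʷ W′)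

record IsDistance (G : Graph) (d : V G → V G → ℕ) : Set where
  field
    geodesic : ∀ u v → Walk G u v (d u v)
    shortest : ∀ {u v k} → Walk G u v k → d u v ≤ k

  edge-bound : ∀ {u w v} → Adj G u w → d u v ≤ suc (d w v)
  edge-bound {w = w} {v} e = shortest (step e (geodesic w v))

  distance : ∀ u v → Dist G u v (d u v)
  distance u v = geodesic u v , λ _ → shortest

  distance-unique : ∀ {u v k} → Dist G u v k → k ≡ d u v
  distance-unique {u} {v} (W , minimal) = ≤-antisym (minimal _ (geodesic u v)) (shortest W)

  resolves-by : ∀ {x u v} → d u x ≢ d v x → Resolves G x u v
  resolves-by {x} {u} {v} ≢ = d u x , d v x , distance u x , distance v x , ≢

  resolves-only : ∀ {x u v} → Resolves G x u v → d u x ≢ d v x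
  resolves-only (_ , _ , du , dv , k₁≢k₂) eq =
    k₁≢k₂ (trans (distance-unique du) (trans eq (sym (distance-unique dv))))

open IsDistance

shiftʷ : ∀ {a b k} → Walk P∞ a b k → Walk P∞ (suc a) (suc b) k
shiftʷ here               = here
shiftʷ (step (inj₁ refl) W) = step (inj₁ refl) (shiftʷ W)
shiftʷ (step (inj₂ refl) W) = step (inj₂ refl) (shiftʷ W)

adjacent-gap : ∀ {a a′} → Adj P∞ a a′ → ∣ a - a′ ∣ ≡ 1
adjacent-gap {a} (inj₁ refl) = subst (λ x → ∣ a - x ∣ ≡ 1) (+-comm a 1) (∣m-m+n∣≡n a 1)
adjacent-gap {a′ = a′} (inj₂ refl) = trans (∣-∣-comm (suc a′) a′) (adjacent-gap {a′} (inj₁ refl))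

path-geodesic : ∀ a b → Walk P∞ a b ∣ a - b ∣
path-geodesic zero    zero    = here
path-geodesic zero    (suc b) = step (inj₁ refl) (shiftʷ (path-geodesic zero b))
path-geodesic (suc a) zero    =
  step (inj₂ refl) (subst (Walk P∞ a 0) (∣-∣-identityʳ a) (path-geodesic a zero))
path-geodesic (suc a) (suc b) = shiftʷ (path-geodesic a b)

-- Each step changes the position by one, so ∣ a - b ∣ is a lower bound.
path-shortest : ∀ {a b k} → Walk P∞ a b k → ∣ a - b ∣ ≤ k
path-shortest {a} here = ≤-reflexive (∣n-n∣≡0 a)
path-shortest {a} {b} {suc k} (step {w = a′} e W) = begin
  ∣ a - b ∣               ≤⟨ ∣-∣-triangle a a′ b ⟩
  ∣ a - a′ ∣ + ∣ a′ - b ∣ ≡⟨ cong (_+ ∣ a′ - b ∣) (adjacent-gap e) ⟩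
  suc ∣ a′ - b ∣          ≤⟨ s≤s (path-shortest W) ⟩
  suc k                   ∎
  where open ≤-Reasoning

path-distance : IsDistance P∞ ∣_-_∣
path-distance = record { geodesic = path-geodesic ; shortest = path-shortest }

δ : ∀ {n} → Fin n → Fin n → ℕ
δ v w with v Fin.≟ w
... | yes _ = 0
... | no _  = 1

δ-self : ∀ {n} (v : Fin n) → δ v v ≡ 0
δ-self v with v Fin.≟ v
... | yes _  = refl
... | no v≢v = ⊥-elim (v≢v refl)

δ-other : ∀ {n} {v w : Fin n} → v ≢ w → δ v w ≡ 1
δ-other {v = v} {w} v≢w with v Fin.≟ w
... | yes v≡w = ⊥-elim (v≢w v≡w)
... | no _    = refl

δ≤1 : ∀ {n} (v w : Fin n) → δ v w ≤ 1
δ≤1 v w with v Fin.≟ w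
... | yes _ = z≤n
... | no _  = s≤s z≤n

complete-geodesic : ∀ {n} (v w : Fin n) → Walk (K n) v w (δ v w)
complete-geodesic v w with v Fin.≟ w
... | yes refl = here
... | no v≢w   = step v≢w here

complete-shortest : ∀ {n} {v w : Fin n} {k} → Walk (K n) v w k → δ v w ≤ k
complete-shortest {v = v} here = ≤-reflexive (δ-self v)
complete-shortest {v = v} {w} (step _ _) = ≤-trans (δ≤1 v w) (s≤s z≤n)

complete-distance : ∀ {n} → IsDistance (K n) δ
complete-distance = record { geodesic = complete-geodesic ; shortest = complete-shortest }

_⊞_ : {A B : Set} → (A → A → ℕ) → (B → B → ℕ) → A × B → A × B → ℕ
(d ⊞ e) (a , v) (b , w) = d a b + e v w

liftˡ : ∀ {G H a b k} {v : V H} → Walk G a b k → Walk (G □ H) (a , v) (b , v) k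
liftˡ here       = here
liftˡ (step e W) = step (inj₂ (refl , e)) (liftˡ W)

liftʳ : ∀ {G H v w k} {a : V G} → Walk H v w k → Walk (G □ H) (a , v) (a , w) k
liftʳ here       = here
liftʳ (step e W) = step (inj₁ (refl , e)) (liftʳ W)

module _ {G H : Graph} {d : V G → V G → ℕ} {e : V H → V H → ℕ}
         (dG : IsDistance G d) (dH : IsDistance H e) where

  -- Each edge of G □ H moves one coordinate along one edge of its factor.
  product-shortest : ∀ {x y k} → Walk (G □ H) x y k → (d ⊞ e) x y ≤ k
  product-shortest here = +-mono-≤ (shortest dG here) (shortest dH here)
  product-shortest {a , v} {b , w} {suc k} (step {w = _ , v′} (inj₁ (refl , v~v′)) W) = begin
    d a b + e v w          ≤⟨ +-monoʳ-≤ (d a b) (edge-bound dH v~v′) ⟩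
    d a b + suc (e v′ w)   ≡⟨ +-suc (d a b) (e v′ w) ⟩
    suc (d a b + e v′ w)   ≤⟨ s≤s (product-shortest W) ⟩
    suc k                  ∎
    where open ≤-Reasoning
  product-shortest {a , v} {b , w} {suc k} (step {w = a′ , _} (inj₂ (refl , a~a′)) W) = begin
    d a b + e v w          ≤⟨ +-monoˡ-≤ (e v w) (edge-bound dG a~a′) ⟩
    suc (d a′ b + e v w)   ≤⟨ s≤s (product-shortest W) ⟩
    suc k                  ∎
    where open ≤-Reasoning

  product-distance : IsDistance (G □ H) (d ⊞ e)
  product-distance = record
    { geodesic = λ { (a , v) (b , w) → liftˡ (geodesic dG a b) ++ʷ liftʳ (geodesic dH v w) }
    ; shortest = product-shortest
    }

other-colour-distance : ∀ {A : Set} {n} (d : A → A → ℕ) a c {v y : Fin n} →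
                        y ≢ v → (d ⊞ δ) (a , v) (c , y) ≡ d a c + 1
other-colour-distance d a c y≢v = cong (d a c +_) (δ-other (≢-sym y≢v))

uncovered : ∀ {k n} (f : Fin k → Fin n) → Injective _≡_ _≡_ f →
            (L : List (Fin n)) → length L < k → ∃[ i ] f i ∉ L
uncovered {k} {n} f f-injective L L<k = ¬∀⟶∃¬ k (λ i → f i ∈ L) (λ i → f i ∈? L) not-covered
  where
  open import Data.List.Membership.DecPropositional (Fin._≟_ {n}) using (_∈?_)

  -- A cover would give an injective map Fin k → Fin (length L).
  not-covered : ¬ (∀ i → f i ∈ L)
  not-covered covered = <⇒notInjective L<k λ {i} {j} same-index → f-injective
    (trans (lookup-index (covered i)) (trans (cong (lookup L) same-index) (sym (lookup-index (covered j)))))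

two-unused : ∀ {m} (L : List (Fin (suc m))) → length L < m →
             ∃[ v ] ∃[ w ] (v ∉ L × w ∉ v ∷ L)
two-unused L few
  with v , v∉ ← uncovered (λ i → i) (λ e → e) L (m<n⇒m<1+n few)
  with w , w∉ ← uncovered (λ i → i) (λ e → e) (v ∷ L) (s≤s few)
  = v , w , v∉ , w∉

colour-blind : ∀ {A : Set} {n} (d : A → A → ℕ) a c {v w y : Fin n} → y ≢ v → y ≢ w →
               (d ⊞ δ) (a , v) (c , y) ≡ (d ⊞ δ) (a , w) (c , y)
colour-blind d a c y≢v y≢w =
  trans (other-colour-distance d a c y≢v) (sym (other-colour-distance d a c y≢w))

-- The argument only uses one layer a of G.
module _ {G : Graph} {d : V G → V G → ℕ} (dG : IsDistance G d) (a : V G) where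

  resolving-lower-bound : ∀ m (T : List (V G × Fin (suc m))) →
                          Resolving (G □ K (suc m)) T → m ≤ length T
  resolving-lower-bound m T resolving = ≮⇒≥ too-small
    where
    colours : List (Fin (suc m))
    colours = map proj₂ T

    -- With fewer than m landmarks, two colours v ≠ w are used by none of them,
    -- and a landmark separating (a , v) from (a , w) would have a third colour.
    too-small : ¬ (length T < m)
    too-small T<m
      with v , w , v∉ , w∉ ← two-unused colours (subst (_< m) (sym (length-map proj₂ T)) T<m)
      with (c , y) , x∈T , x-resolves ← find (resolving (a , v) (a , w) λ e → w∉ (here (sym (cong proj₂ e))))
      = resolves-only (product-distance dG complete-distance) x-resolves
          (colour-blind d a c (λ e → v∉ (subst (_∈ colours) e y∈colours))
                                  (λ e → w∉ (there (subst (_∈ colours) e y∈colours))))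
      where
      y∈colours : y ∈ colours
      y∈colours = ∈-map⁺ proj₂ x∈T

D : ∀ {n} → ℕ × Fin n → ℕ × Fin n → ℕ
D = ∣_-_∣ ⊞ δ

ladder-distance : ∀ {n} → IsDistance (P∞ □ K n) D
ladder-distance = product-distance path-distance complete-distance

landmark∈S : ∀ {m} {i : Fin m} {v} → inject₁ i ≡ v → (0 , v) ∈ basisS m
landmark∈S {m} {i} refl = ∈-map⁺ (λ j → 0 , inject₁ j) (∈-allFin i)

some-landmark-colour : ∀ {m} {v w : Fin (suc m)} → v ≢ w →
                       (∃[ i ] inject₁ i ≡ v) ⊎ (∃[ i ] inject₁ i ≡ w)
some-landmark-colour {m} {v} {w} v≢w with m ≟ toℕ v | m ≟ toℕ w
... | no m≢v  | _        = inj₁ (lower₁ v m≢v , inject₁-lower₁ v m≢v)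
... | yes _   | no m≢w   = inj₂ (lower₁ w m≢w , inject₁-lower₁ w m≢w)
... | yes m≡v | yes m≡w  = ⊥-elim (v≢w (toℕ-injective (trans (sym m≡v) m≡w)))

own-colour : ∀ {n} a {v w : Fin n} → v ≢ w → D (a , v) (0 , v) ≢ D (a , w) (0 , v)
own-colour a {v} {w} v≢w eq = 1+n≢n (sym (+-cancelˡ-≡ ∣ a - 0 ∣ 0 1 (begin
  ∣ a - 0 ∣ + 0     ≡⟨ cong (∣ a - 0 ∣ +_) (sym (δ-self v)) ⟩
  D (a , v) (0 , v) ≡⟨ eq ⟩
  D (a , w) (0 , v) ≡⟨ other-colour-distance ∣_-_∣ a 0 v≢w ⟩
  ∣ a - 0 ∣ + 1     ∎)))
  where open ≡-Reasoning

-- A landmark of a third colour sees the layers a and b at distances a + 1 and b + 1.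
foreign-colour : ∀ {n} {a b} {v w y : Fin n} → a ≢ b → y ≢ v → y ≢ w →
                 D (a , v) (0 , y) ≢ D (b , w) (0 , y)
foreign-colour {a = a} {b} {v} {w} {y} a≢b y≢v y≢w eq = a≢b (begin
  a          ≡⟨ ∣-∣-identityʳ a ⟨
  ∣ a - 0 ∣  ≡⟨ +-cancelʳ-≡ 1 ∣ a - 0 ∣ ∣ b - 0 ∣ same-distance ⟩
  ∣ b - 0 ∣  ≡⟨ ∣-∣-identityʳ b ⟩
  b          ∎)
  where
  open ≡-Reasoning
  same-distance : ∣ a - 0 ∣ + 1 ≡ ∣ b - 0 ∣ + 1
  same-distance = begin
    ∣ a - 0 ∣ + 1      ≡⟨ other-colour-distance ∣_-_∣ a 0 y≢v ⟨
    D (a , v) (0 , y)  ≡⟨ eq ⟩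
    D (b , w) (0 , y)  ≡⟨ other-colour-distance ∣_-_∣ b 0 y≢w ⟩
    ∣ b - 0 ∣ + 1      ∎

ResolvedByS : ∀ m → (u u′ : ℕ × Fin (suc m)) → Set
ResolvedByS m u u′ = Any (λ x → Resolves (P∞ □ K (suc m)) x u u′) (basisS m)

same-layer-resolved : ∀ {m} a {v w : Fin (suc m)} → v ≢ w → ResolvedByS m (a , v) (a , w)
same-layer-resolved a v≢w with some-landmark-colour v≢w
... | inj₁ (_ , i≡v) = lose (landmark∈S i≡v) (resolves-by ladder-distance (own-colour a v≢w))
... | inj₂ (_ , i≡w) = lose (landmark∈S i≡w) (resolves-by ladder-distance (≢-sym (own-colour a (≢-sym v≢w))))

different-layers-resolved : ∀ {m} {a b} {v w : Fin (suc m)} → 3 ≤ m → a ≢ b →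
                            ResolvedByS m (a , v) (b , w)
different-layers-resolved {v = v} {w} 3≤m a≢b
  with i , i∉ ← uncovered inject₁ inject₁-injective (v ∷ w ∷ []) 3≤m
  = lose (landmark∈S refl) (resolves-by ladder-distance
           (foreign-colour a≢b (λ e → i∉ (here e)) (λ e → i∉ (there (here e)))))

basis-resolving : ∀ m → 3 ≤ m → Resolving (P∞ □ K (suc m)) (basisS m)
basis-resolving m 3≤m (a , v) (b , w) u≢u′ with a ≟ b
... | yes refl = same-layer-resolved a (λ e → u≢u′ (cong (a ,_) e))
... | no a≢b   = different-layers-resolved 3≤m a≢b

basis-unique : ∀ m → Unique (basisS m)
basis-unique m = Unique.map⁺ (λ e → inject₁-injective (cong proj₂ e)) (Unique.allFin⁺ m)

basis-length : ∀ m → length (basisS m) ≡ m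
basis-length m = trans (length-map _ (allFin m)) (length-tabulate (λ i → i))

proposition8 : ∀ (m : ℕ) → 4 ≤ suc m →
    MetricDim (P∞ □ K (suc m)) (suc m ∸ 1) × IsMetricBasis (P∞ □ K (suc m)) (basisS m)
proposition8 m 4≤n =
  ((basisS m , basis-unique m , resolving , basis-length m) , minimal) ,
  (basis-unique m , resolving ,
   λ T T-unique T-resolving → subst (_≤ length T) (sym (basis-length m)) (minimal T T-unique T-resolving))
  where
  resolving : Resolving (P∞ □ K (suc m)) (basisS m)
  resolving = basis-resolving m (s≤s⁻¹ 4≤n)

  minimal : ∀ T → Unique T → Resolving (P∞ □ K (suc m)) T → m ≤ length T
  minimal T _ = resolving-lower-bound path-distance 0 m T
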